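{- If $r:A\wedge B$ is a closed term that is $\hookrightarrow_{\rightleftarrows}$-normal (there is no $s$ with $r\hookrightarrow_{\rightleftarrows}s$), then $r\rightleftarrows^* r_1\times r_2$ for some terms $r_1:A$ and $r_2:B$.
   Context: Types are generated by $A ::= \tau \mid A\Rightarrow A \mid A\wedge A$, where $\tau$ is the only atomic type ($\Rightarrow$ associates to the right). Type equivalence $\equiv$ is the smallest congruence on types such that $A\wedge B\equiv B\wedge A$, $A\wedge(B\wedge C)\equiv(A\wedge B)\wedge C$, $A\Rightarrow(B\wedge C)\equiv(A\Rightarrow B)\wedge(A\Rightarrow C)$ and $(A\wedge B)\Rightarrow C\equiv A\Rightarrow B\Rightarrow C$. To each type $A$ is associated an infinite set of variables $\mathcal V_A$, with $\mathcal V_A=\mathcal V_B$ if $A\equiv B$ and $\mathcal V_A\cap\mathcal V_B=\emptyset$ otherwise. Preterms are $r ::= x \mid \lambda x.r \mid rr \mid r\times r \mid \pi_A(r)$ (application left associative); one writes $\lambda x^A.r$ for $\lambda x.r$ when $x\in\mathcal V_A$. Introductions are abstractions and products; eliminations are applications and projections. A term is closed if it has no free variables. Typing $r:A$ (without contexts): $x:A$ if $x\in\mathcal V_A$; if $r:A$ and $A\equiv B$ then $r:B$; if $r:B$ then $\lambda x^A.r:A\Rightarrow B$; if $r:A\Rightarrow B$ and $s:A$ then $rs:B$; if $r:A$ and $s:B$ then $r\times s:A\wedge B$; if $r:A\wedge B$ then $\pi_A(r):A$. Terms are well-typed preterms. $\rightleftarrows$ is the smallest symmetric relation, closed under all term contexts,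 containing $r\times s\rightleftarrows s\times r$, $(r\times s)\times t\rightleftarrows r\times(s\times t)$, $\lambda x^A.(r\times s)\rightleftarrows \lambda x^A.r\times\lambda x^A.s$, $rst\rightleftarrows r(s\times t)$; $\rightleftarrows^*$ is its reflexive transitive closure. Reduction: $\to_{\beta\pi\zeta}$: if $s:A$ then $(\lambda x^A.r)s\to_{\beta\pi\zeta} r[s/x]$; if $r:A$ then $\pi_A(r\times s)\to_{\beta\pi\zeta} r$; $(r\times s)t\to_{\beta\pi\zeta} rt\times st$. $\to_{\eta\delta}$: if $r:A\Rightarrow B$, $r$ is an elimination or a variable, and $x\in\mathcal V_A$ fresh, then $r\to_{\eta\delta}\lambda x^A.(rx)$; if $r:A\wedge B$ and $r$ is an elimination or a variable, then $r\to_{\eta\delta}\pi_A(r)\times\pi_B(r)$. The relations $\hookrightarrow$ and $\to$ are the smallest relations such that: $r\to_{\beta\pi\zeta}s$ implies $r\hookrightarrow s$; $r\to_{\eta\delta}s$ implies $r\to s$; $r\hookrightarrow s$ implies $r\to s$; $r\to s$ implies $\lambda x.r\hookrightarrow\lambda x.s$; $r\hookrightarrow s$ implies $rt\hookrightarrow st$; $r\to s$ implies $tr\hookrightarrow ts$, $r\times t\hookrightarrow s\times t$, $t\times r\hookrightarrow t\times s$; $r\hookrightarrow s$ implies $\pi_A(r)\hookrightarrow\pi_A(s)$. $r\hookrightarrow_{\rightleftarrows} s$ iff $r\rightleftarrows^* r'\hookrightarrow s'\rightleftarrows^* s$ for some $r',s'$. -}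

module Defs where

open import Data.Nat using (ℕ; zero; suc; _+_; _<ᵇ_; compare; less; equal; greater)
open import Data.Bool using (if_then_else_)
open import Data.List using (List; []; _∷_)
open import Data.Product using (Σ; _×_; Σ-syntax)
open import Relation.Binary.Construct.Closure.ReflexiveTransitive using (Star)

infixr 7 _⇒_
infixr 8 _∧_

data Ty : Set where
  τ   : Ty
  _⇒_ : Ty → Ty → Ty
  _∧_ : Ty → Ty → Ty

infix 4 _≡ₜ_
data _≡ₜ_ : Ty → Ty → Set where
  ≡ₜ-refl  : ∀ {A} → A ≡ₜ A
  ≡ₜ-sym   : ∀ {A B} → A ≡ₜ B → B ≡ₜ A
  ≡ₜ-trans : ∀ {A B C} → A ≡ₜ B → B ≡ₜ C → A ≡ₜ C
  ∧-comm   : ∀ {A B} → A ∧ B ≡ₜ B ∧ A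
  ∧-assoc  : ∀ {A B C} → A ∧ (B ∧ C) ≡ₜ (A ∧ B) ∧ C
  ⇒-distr  : ∀ {A B C} → A ⇒ (B ∧ C) ≡ₜ (A ⇒ B) ∧ (A ⇒ C)
  ⇒-curry  : ∀ {A B C} → (A ∧ B) ⇒ C ≡ₜ A ⇒ B ⇒ C
  ⇒-cong   : ∀ {A A' B B'} → A ≡ₜ A' → B ≡ₜ B' → A ⇒ B ≡ₜ A' ⇒ B'
  ∧-cong   : ∀ {A A' B B'} → A ≡ₜ A' → B ≡ₜ B' → A ∧ B ≡ₜ A' ∧ B'

-- Preterms, with de Bruijn indices; binders and projections carry the
-- type annotation (λx^A.r is written ƛ A r, π_A(r) is π A r).

infixl 9 _·_
infixr 6 _⊗_

data Tm : Set where
  var : ℕ → Tm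
  ƛ   : Ty → Tm → Tm
  _·_ : Tm → Tm → Tm
  _⊗_ : Tm → Tm → Tm
  π   : Ty → Tm → Tm

shift : ℕ → ℕ → Tm → Tm
shift d c (var i) = if i <ᵇ c then var i else var (d + i)
shift d c (ƛ A r) = ƛ A (shift d (suc c) r)
shift d c (r · s) = shift d c r · shift d c s
shift d c (r ⊗ s) = shift d c r ⊗ shift d c s
shift d c (π A r) = π A (shift d c r)

-- subst k s r : substitute s for index k in r (removing the binder)
subst : ℕ → Tm → Tm → Tm
subst k s (var i) with compare i k
... | less _ _    = var i
... | equal _     = shift k 0 s
... | greater _ m = var (k + m)
subst k s (ƛ A r) = ƛ A (subst (suc k) s r)
subst k s (r · t) = subst k s r · subst k s t
subst k s (r ⊗ t) = subst k s r ⊗ subst k s t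
subst k s (π A r) = π A (subst k s r)

_[_/0] : Tm → Tm → Tm
r [ s /0] = subst 0 s r

-- Typing.  Contexts record the annotations of the enclosing binders
-- (innermost first), i.e. the sets V_A the bound variables belong to.

Ctx : Set
Ctx = List Ty

infix 4 _∋_∶_
data _∋_∶_ : Ctx → ℕ → Ty → Set where
  here  : ∀ {Γ A} → (A ∷ Γ) ∋ 0 ∶ A
  there : ∀ {Γ A B i} → Γ ∋ i ∶ A → (B ∷ Γ) ∋ suc i ∶ A

infix 4 _⊢_∶_
data _⊢_∶_ (Γ : Ctx) : Tm → Ty → Set where
  ty-var  : ∀ {i A} → Γ ∋ i ∶ A → Γ ⊢ var i ∶ A
  ty-conv : ∀ {r A B} → Γ ⊢ r ∶ A → A ≡ₜ B → Γ ⊢ r ∶ B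
  ty-lam  : ∀ {r A B} → (A ∷ Γ) ⊢ r ∶ B → Γ ⊢ ƛ A r ∶ A ⇒ B
  ty-app  : ∀ {r s A B} → Γ ⊢ r ∶ A ⇒ B → Γ ⊢ s ∶ A → Γ ⊢ r · s ∶ B
  ty-pair : ∀ {r s A B} → Γ ⊢ r ∶ A → Γ ⊢ s ∶ B → Γ ⊢ r ⊗ s ∶ A ∧ B
  ty-proj : ∀ {r A B} → Γ ⊢ r ∶ A ∧ B → Γ ⊢ π A r ∶ A

-- r is a term (well-typed preterm) in context Γ
Typable : Ctx → Tm → Set
Typable Γ r = Σ Ty (λ A → Γ ⊢ r ∶ A)

infix 4 _⇄_
data _⇄_ : Tm → Tm → Set where
  ⇄-comm  : ∀ {r s} → r ⊗ s ⇄ s ⊗ r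
  ⇄-assoc : ∀ {r s t} → (r ⊗ s) ⊗ t ⇄ r ⊗ (s ⊗ t)
  ⇄-dist  : ∀ {A r s} → ƛ A (r ⊗ s) ⇄ ƛ A r ⊗ ƛ A s
  ⇄-curry : ∀ {r s t} → r · s · t ⇄ r · (s ⊗ t)
  ⇄-sym   : ∀ {r s} → r ⇄ s → s ⇄ r
  ⇄-lam   : ∀ {A r s} → r ⇄ s → ƛ A r ⇄ ƛ A s
  ⇄-appL  : ∀ {r s t} → r ⇄ s → r · t ⇄ s · t
  ⇄-appR  : ∀ {r s t} → r ⇄ s → t · r ⇄ t · s
  ⇄-pairL : ∀ {r s t} → r ⇄ s → r ⊗ t ⇄ s ⊗ t
  ⇄-pairR : ∀ {r s t} → r ⇄ s → t ⊗ r ⇄ t ⊗ s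
  ⇄-proj  : ∀ {A r s} → r ⇄ s → π A r ⇄ π A s

_⊢_⇄ₜ_ : Ctx → Tm → Tm → Set
Γ ⊢ r ⇄ₜ s = Typable Γ r × (r ⇄ s) × Typable Γ s

_⊢_⇄*_ : Ctx → Tm → Tm → Set
Γ ⊢ r ⇄* s = Star (Γ ⊢_⇄ₜ_) r s

data ElimOrVar : Tm → Set where
  ev-var  : ∀ {i} → ElimOrVar (var i)
  ev-app  : ∀ {r s} → ElimOrVar (r · s)
  ev-proj : ∀ {A r} → ElimOrVar (π A r)

infix 4 _⊢_→βπζ_ _⊢_→ηδ_ _⊢_↪_ _⊢_⟶_
data _⊢_→βπζ_ (Γ : Ctx) : Tm → Tm → Set where
  β : ∀ {A r s} → Γ ⊢ s ∶ A → Γ ⊢ ƛ A r · s →βπζ r [ s /0]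
  π : ∀ {A r s} → Γ ⊢ r ∶ A → Γ ⊢ π A (r ⊗ s) →βπζ r
  ζ : ∀ {r s t} → Γ ⊢ (r ⊗ s) · t →βπζ r · t ⊗ s · t

-- η: the fresh variable x ∈ V_A is the new bound index 0
data _⊢_→ηδ_ (Γ : Ctx) : Tm → Tm → Set where
  η : ∀ {A B r} → Γ ⊢ r ∶ A ⇒ B → ElimOrVar r →
      Γ ⊢ r →ηδ ƛ A (shift 1 0 r · var 0)
  δ : ∀ {A B r} → Γ ⊢ r ∶ A ∧ B → ElimOrVar r →
      Γ ⊢ r →ηδ π A r ⊗ π B r

data _⊢_↪_ : Ctx → Tm → Tm → Set
data _⊢_⟶_ : Ctx → Tm → Tm → Set

data _⊢_↪_ where
  ↪-βπζ  : ∀ {Γ r s} → Γ ⊢ r →βπζ s → Γ ⊢ r ↪ s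
  ↪-lam  : ∀ {Γ A r s} → (A ∷ Γ) ⊢ r ⟶ s → Γ ⊢ ƛ A r ↪ ƛ A s
  ↪-appL : ∀ {Γ r s t} → Γ ⊢ r ↪ s → Γ ⊢ r · t ↪ s · t
  ↪-appR : ∀ {Γ r s t} → Γ ⊢ r ⟶ s → Γ ⊢ t · r ↪ t · s
  ↪-pairL : ∀ {Γ r s t} → Γ ⊢ r ⟶ s → Γ ⊢ r ⊗ t ↪ s ⊗ t
  ↪-pairR : ∀ {Γ r s t} → Γ ⊢ r ⟶ s → Γ ⊢ t ⊗ r ↪ t ⊗ s
  ↪-proj : ∀ {Γ A r s} → Γ ⊢ r ↪ s → Γ ⊢ π A r ↪ π A s

data _⊢_⟶_ where
  ⟶-ηδ : ∀ {Γ r s} → Γ ⊢ r →ηδ s → Γ ⊢ r ⟶ s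
  ⟶-↪  : ∀ {Γ r s} → Γ ⊢ r ↪ s → Γ ⊢ r ⟶ s

infix 4 _⊢_↪⇄_
_⊢_↪⇄_ : Ctx → Tm → Tm → Set
Γ ⊢ r ↪⇄ s = Σ[ r' ∈ Tm ] Σ[ s' ∈ Tm ]
  (Typable Γ r × Typable Γ r' × Typable Γ s' × Typable Γ s ×
   Γ ⊢ r ⇄* r' × Γ ⊢ r' ↪ s' × Γ ⊢ s' ⇄* s)

module Submission where

-- Every type is equivalent to the conjunction of its list of
-- factors ('factors'), and equivalent types have factor lists that
-- are permutations of each other.  Conjunctions of (possibly empty)
-- lists of types live in the commutative monoid obtained by adjoining a
-- unit to (Ty, ≡ₜ, ∧).  Since a permutation L ↭ A ++ B pulls back to an
-- interleaving of L, this yields two decomposition principles: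
-- '⇒-split' (C ⇒ D ≡ₜ A ∧ B forces D ≡ₜ D₁ ∧ D₂ with A ≡ₜ C ⇒ D₁,
-- B ≡ₜ C ⇒ D₂) and '∧-refine' (X₁ ∧ X₂ ≡ₜ A ∧ B refines into four
-- possibly empty parts).
--
-- We work with the untyped closure ≃ of ⇄, which preserves
-- typing, so untyped chains from a typed term are chains of terms.
-- A ⟶-normal term t of type A ∧ B (in any context) splits as t ≃ a ⊗ b
-- ('split-normal'): variables and eliminations are δ-redexes,
-- abstractions split by '⇒-split' and ⇄-dist, pairs by '∧-refine',
-- splitting the components partially and regrouping them by the
-- interchange law of ⊗.  For a closed ↪-normal term ('split-closed')
-- the head is not a variable, and a projection or an application would
-- expose a π- or ζ-redex; introductions are ⟶-normal because η and δ
-- never apply to them.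

open import Defs
open import Data.Bool using (Bool; true; false)
open import Data.Empty using (⊥; ⊥-elim)
open import Data.List using (List; []; _∷_; _++_; map; foldr)
import Data.List.Properties as List
import Data.List.Relation.Binary.Pointwise as Pointwiseᴸ
open Pointwiseᴸ using ([]; _∷_)
import Data.List.Relation.Binary.Permutation.Propositional as ↭≡
open import Data.List.Relation.Ternary.Interleaving using ([])
open import Data.List.Relation.Ternary.Interleaving.Propositional
  using (Interleaving; consˡ; consʳ; toPermutation)
open import Data.List.Relation.Ternary.Interleaving.Propositional.Properties
  using (++-linear)
open import Data.Maybe using (Maybe; just; nothing)
import Data.Maybe as Maybe
open import Data.Maybe.Relation.Binary.Pointwise using (Pointwise; just; nothing)
open import Data.Product using (Σ-syntax; ∃₂; _×_; _,_)
open import Level using (0ℓ)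
open import Relation.Nullary using (¬_)
open import Relation.Binary.Core using (Rel)
open import Relation.Binary.Bundles using (Setoid)
open import Relation.Binary.Structures using (IsEquivalence)
open import Relation.Binary.PropositionalEquality as ≡ using (_≡_; refl)
open import Relation.Binary.Construct.Closure.ReflexiveTransitive
  using (Star; ε; _◅_; _◅◅_; gmap; reverse)
open import Algebra.Core using (Op₂)
open import Algebra.Bundles using (CommutativeMonoid)
open import Algebra.Structures using (IsCommutativeSemigroup)
open import Algebra.Construct.Add.Identity using (liftOp)
  renaming (isMonoid to liftOp-isMonoid)
import Algebra.Properties.CommutativeSemigroup as CommutativeSemigroupProperties
import Relation.Binary.Construct.Add.Point.Equality as PointEquality
open PointEquality using ([_]; ∙≈∙)

module AdjoinUnit {A : Set} {_≈_ : Rel A 0ℓ} {_∙_ : Op₂ A}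
                  (isCommutativeSemigroup : IsCommutativeSemigroup _≈_ _∙_) where

  open IsCommutativeSemigroup isCommutativeSemigroup using (isSemigroup; comm)
    renaming (refl to ≈-refl)

  liftOp-comm : ∀ p q →
    PointEquality._≈∙_ _≈_ (liftOp _∙_ p q) (liftOp _∙_ q p)
  liftOp-comm (just x) (just y) = [ comm x y ]
  liftOp-comm (just x) nothing  = [ ≈-refl ]
  liftOp-comm nothing  (just y) = [ ≈-refl ]
  liftOp-comm nothing  nothing  = ∙≈∙

  commutativeMonoid : CommutativeMonoid 0ℓ 0ℓ
  commutativeMonoid = record
    { isCommutativeMonoid = record
      { isMonoid = liftOp-isMonoid isSemigroup
      ; comm     = liftOp-comm
      }
    }

≡ₜ-isEquivalence : IsEquivalence _≡ₜ_
≡ₜ-isEquivalence = record { refl = ≡ₜ-refl ; sym = ≡ₜ-sym ; trans = ≡ₜ-trans }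

Ty-setoid : Setoid 0ℓ 0ℓ
Ty-setoid = record { isEquivalence = ≡ₜ-isEquivalence }

∧-isCommutativeSemigroup : IsCommutativeSemigroup _≡ₜ_ _∧_
∧-isCommutativeSemigroup = record
  { isSemigroup = record
    { isMagma = record { isEquivalence = ≡ₜ-isEquivalence ; ∙-cong = ∧-cong }
    ; assoc   = λ _ _ _ → ≡ₜ-sym ∧-assoc
    }
  ; comm = λ _ _ → ∧-comm
  }

-- Optional types: 'nothing' is the empty conjunction.
infixr 8 _∧̂_
infix 4 _≈̂_

_∧̂_ : Maybe Ty → Maybe Ty → Maybe Ty
_∧̂_ = liftOp _∧_

_≈̂_ : Rel (Maybe Ty) 0ℓ
_≈̂_ = PointEquality._≈∙_ _≡ₜ_

∧̂-commutativeMonoid : CommutativeMonoid 0ℓ 0ℓ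
∧̂-commutativeMonoid = AdjoinUnit.commutativeMonoid ∧-isCommutativeSemigroup

module OptTy = CommutativeMonoid ∧̂-commutativeMonoid

open import Data.List.Relation.Binary.Equality.Setoid Ty-setoid using (_≋_)
import Data.List.Relation.Binary.Permutation.Setoid Ty-setoid as ↭
open ↭ using (_↭_; ↭-refl; ↭-sym; ↭-trans; ↭-reflexive)
import Data.List.Relation.Binary.Permutation.Setoid.Properties Ty-setoid as ↭ₚ
import Data.List.Relation.Binary.Permutation.Setoid.Properties OptTy.setoid
  as OptTy↭ₚ

factors : Ty → List Ty
factors τ       = τ ∷ []
factors (A ⇒ B) = map (A ⇒_) (factors B)
factors (A ∧ B) = factors A ++ factors B

⋀ : List Ty → Maybe Ty
⋀ L = foldr _∧̂_ nothing (map just L)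

⋀-↭ : ∀ {L M} → L ↭ M → ⋀ L ≈̂ ⋀ M
⋀-↭ L↭M = OptTy↭ₚ.foldr-commMonoid OptTy.isCommutativeMonoid
  (↭ₚ.map⁺ OptTy.setoid [_] L↭M)

⋀-++ : ∀ L M → ⋀ (L ++ M) ≈̂ ⋀ L ∧̂ ⋀ M
⋀-++ []      M = OptTy.sym (OptTy.identityˡ (⋀ M))
⋀-++ (A ∷ L) M = OptTy.trans (OptTy.∙-congˡ (⋀-++ L M))
                             (OptTy.sym (OptTy.assoc (just A) (⋀ L) (⋀ M)))

-- C ⇒_ acting on optional types; by ⇒-distr it is a monoid morphism.
infixr 7 _⇒̂_
_⇒̂_ : Ty → Maybe Ty → Maybe Ty
C ⇒̂ p = Maybe.map (C ⇒_) p

⇒̂-cong : ∀ {C p q} → p ≈̂ q → C ⇒̂ p ≈̂ C ⇒̂ q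
⇒̂-cong [ p≡q ] = [ ⇒-cong ≡ₜ-refl p≡q ]
⇒̂-cong ∙≈∙     = ∙≈∙

⇒̂-distrib : ∀ C p q → C ⇒̂ (p ∧̂ q) ≈̂ (C ⇒̂ p) ∧̂ (C ⇒̂ q)
⇒̂-distrib C (just A) (just B) = [ ⇒-distr ]
⇒̂-distrib C (just A) nothing  = OptTy.refl
⇒̂-distrib C nothing  (just B) = OptTy.refl
⇒̂-distrib C nothing  nothing  = OptTy.refl

⋀-map : ∀ C L → ⋀ (map (C ⇒_) L) ≈̂ C ⇒̂ ⋀ L
⋀-map C []      = ∙≈∙
⋀-map C (A ∷ L) = OptTy.trans (OptTy.∙-congˡ (⋀-map C L))
                              (OptTy.sym (⇒̂-distrib C (just A) (⋀ L)))

⋀-factors : ∀ X → ⋀ (factors X) ≈̂ just X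
⋀-factors τ       = OptTy.refl
⋀-factors (A ⇒ B) = OptTy.trans (⋀-map A (factors B)) (⇒̂-cong (⋀-factors B))
⋀-factors (A ∧ B) = OptTy.trans (⋀-++ (factors A) (factors B))
                                (OptTy.∙-cong (⋀-factors A) (⋀-factors B))

map-≈ : ∀ {f g : Ty → Ty} → (∀ x → f x ≡ₜ g x) → ∀ L → map f L ↭ map g L
map-≈ f≈g L = ↭.refl (Pointwiseᴸ.map⁺ _ _ (Pointwiseᴸ.refl (f≈g _)))

factors-↭ : ∀ {A B} → A ≡ₜ B → factors A ↭ factors B
factors-↭ ≡ₜ-refl          = ↭-refl
factors-↭ (≡ₜ-sym e)       = ↭-sym (factors-↭ e)
factors-↭ (≡ₜ-trans e e')  = ↭-trans (factors-↭ e) (factors-↭ e')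
factors-↭ (∧-comm {A} {B}) = ↭ₚ.++-comm (factors A) (factors B)
factors-↭ (∧-assoc {A} {B} {C}) =
  ↭-sym (↭ₚ.++-assoc (factors A) (factors B) (factors C))
factors-↭ (⇒-distr {A} {B} {C}) =
  ↭-reflexive (List.map-++ (A ⇒_) (factors B) (factors C))
factors-↭ (⇒-curry {C = C}) =
  ↭-trans (map-≈ (λ _ → ⇒-curry) (factors C)) (↭-reflexive (List.map-∘ (factors C)))
factors-↭ (⇒-cong {B = B} e e') =
  ↭-trans (map-≈ (λ _ → ⇒-cong e ≡ₜ-refl) (factors B))
          (↭ₚ.map⁺ Ty-setoid (⇒-cong ≡ₜ-refl) (factors-↭ e'))
factors-↭ (∧-cong e e') = ↭ₚ.++⁺ (factors-↭ e) (factors-↭ e')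

conj-of-↭ : ∀ {X L} → L ↭ factors X → just X ≈̂ ⋀ L
conj-of-↭ {X} L↭X = OptTy.trans (OptTy.sym (⋀-factors X)) (⋀-↭ (↭-sym L↭X))

InterleavingUpTo : Rel (List Ty) 0ℓ → List Ty → List Ty → List Ty → Set
InterleavingUpTo R L m₁ m₂ =
  ∃₂ λ l₁ l₂ → Interleaving l₁ l₂ L × R l₁ m₁ × R l₂ m₂

pull-≋ : ∀ {L M m₁ m₂} → L ≋ M → Interleaving m₁ m₂ M →
  InterleavingUpTo _≋_ L m₁ m₂
pull-≋ [] [] = [] , [] , [] , [] , []
pull-≋ (e ∷ L≋M) (consˡ sp) =
  let (l₁ , l₂ , sp' , e₁ , e₂) = pull-≋ L≋M sp
  in  _ ∷ l₁ , l₂ , consˡ sp' , e ∷ e₁ , e₂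
pull-≋ (e ∷ L≋M) (consʳ sp) =
  let (l₁ , l₂ , sp' , e₁ , e₂) = pull-≋ L≋M sp
  in  l₁ , _ ∷ l₂ , consʳ sp' , e₁ , e ∷ e₂

-- An interleaving of M pulls back along L ↭ M, by induction on the
-- permutation; in the swap case each of the two swapped elements stays
-- on the side the interleaving assigns it.
pull-↭ : ∀ {L M m₁ m₂} → L ↭ M → Interleaving m₁ m₂ M →
  InterleavingUpTo _↭_ L m₁ m₂
pull-↭ (↭.refl L≋M) sp =
  let (l₁ , l₂ , sp' , e₁ , e₂) = pull-≋ L≋M sp
  in  l₁ , l₂ , sp' , ↭.refl e₁ , ↭.refl e₂
pull-↭ (↭.prep e p) (consˡ sp) =
  let (l₁ , l₂ , sp' , p₁ , p₂) = pull-↭ p sp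
  in  _ ∷ l₁ , l₂ , consˡ sp' , ↭.prep e p₁ , p₂
pull-↭ (↭.prep e p) (consʳ sp) =
  let (l₁ , l₂ , sp' , p₁ , p₂) = pull-↭ p sp
  in  l₁ , _ ∷ l₂ , consʳ sp' , p₁ , ↭.prep e p₂
pull-↭ (↭.swap e e' p) (consˡ (consˡ sp)) =
  let (l₁ , l₂ , sp' , p₁ , p₂) = pull-↭ p sp
  in  _ ∷ _ ∷ l₁ , l₂ , consˡ (consˡ sp') , ↭.swap e e' p₁ , p₂
pull-↭ (↭.swap e e' p) (consˡ (consʳ sp)) =
  let (l₁ , l₂ , sp' , p₁ , p₂) = pull-↭ p sp
  in  _ ∷ l₁ , _ ∷ l₂ , consʳ (consˡ sp') , ↭.prep e' p₁ , ↭.prep e p₂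
pull-↭ (↭.swap e e' p) (consʳ (consˡ sp)) =
  let (l₁ , l₂ , sp' , p₁ , p₂) = pull-↭ p sp
  in  _ ∷ l₁ , _ ∷ l₂ , consˡ (consʳ sp') , ↭.prep e p₁ , ↭.prep e' p₂
pull-↭ (↭.swap e e' p) (consʳ (consʳ sp)) =
  let (l₁ , l₂ , sp' , p₁ , p₂) = pull-↭ p sp
  in  l₁ , _ ∷ _ ∷ l₂ , consʳ (consʳ sp') , p₁ , ↭.swap e e' p₂
pull-↭ (↭.trans p q) sp =
  let (k₁ , k₂ , spq , q₁ , q₂) = pull-↭ q sp
      (l₁ , l₂ , spp , p₁ , p₂) = pull-↭ p spq
  in  l₁ , l₂ , spp , ↭-trans p₁ q₁ , ↭-trans p₂ q₂

split-↭ : ∀ {L} A B → L ↭ A ++ B → InterleavingUpTo _↭_ L A B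
split-↭ A B L↭A++B = pull-↭ L↭A++B (++-linear A B)

interleaving-↭ : ∀ {l₁ l₂ L} → Interleaving l₁ l₂ L → L ↭ l₁ ++ l₂
interleaving-↭ sp = ↭≡.↭⇒↭ₛ′ ≡ₜ-isEquivalence (toPermutation sp)

interleave-++⁻ : ∀ xs {ys l₁ l₂} → Interleaving l₁ l₂ (xs ++ ys) →
  Σ[ xa ∈ List Ty ] Σ[ xb ∈ List Ty ] Σ[ ya ∈ List Ty ] Σ[ yb ∈ List Ty ]
  (Interleaving xa xb xs × Interleaving ya yb ys × l₁ ≡ xa ++ ya × l₂ ≡ xb ++ yb)
interleave-++⁻ []       sp = [] , [] , _ , _ , [] , sp , refl , refl
interleave-++⁻ (x ∷ xs) (consˡ sp) with interleave-++⁻ xs sp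
... | xa , xb , ya , yb , sp₁ , sp₂ , refl , refl =
  x ∷ xa , xb , ya , yb , consˡ sp₁ , sp₂ , refl , refl
interleave-++⁻ (x ∷ xs) (consʳ sp) with interleave-++⁻ xs sp
... | xa , xb , ya , yb , sp₁ , sp₂ , refl , refl =
  xa , x ∷ xb , ya , yb , consʳ sp₁ , sp₂ , refl , refl

interleave-map⁻ : ∀ (f : Ty → Ty) L {l₁ l₂} → Interleaving l₁ l₂ (map f L) →
  Σ[ d₁ ∈ List Ty ] Σ[ d₂ ∈ List Ty ]
  (Interleaving d₁ d₂ L × l₁ ≡ map f d₁ × l₂ ≡ map f d₂)
interleave-map⁻ f []      []         = [] , [] , [] , refl , refl
interleave-map⁻ f (x ∷ L) (consˡ sp) with interleave-map⁻ f L sp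
... | d₁ , d₂ , sp' , refl , refl = x ∷ d₁ , d₂ , consˡ sp' , refl , refl
interleave-map⁻ f (x ∷ L) (consʳ sp) with interleave-map⁻ f L sp
... | d₁ , d₂ , sp' , refl , refl = d₁ , x ∷ d₂ , consʳ sp' , refl , refl

⋀-interleave : ∀ {l₁ l₂ L} → Interleaving l₁ l₂ L → ⋀ L ≈̂ ⋀ l₁ ∧̂ ⋀ l₂
⋀-interleave {l₁} {l₂} sp = OptTy.trans (⋀-↭ (interleaving-↭ sp)) (⋀-++ l₁ l₂)

⇒-factors : ∀ C ds {A} → just A ≈̂ ⋀ (map (C ⇒_) ds) →
  Σ[ D ∈ Ty ] (⋀ ds ≈̂ just D × A ≡ₜ C ⇒ D)
⇒-factors C ds A≈ with ⋀ ds | OptTy.trans A≈ (⋀-map C ds)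
... | just D | [ A≡C⇒D ] = D , OptTy.refl , A≡C⇒D

⇒-split : ∀ {C D A B} → C ⇒ D ≡ₜ A ∧ B →
  Σ[ D₁ ∈ Ty ] Σ[ D₂ ∈ Ty ] (D ≡ₜ D₁ ∧ D₂ × A ≡ₜ C ⇒ D₁ × B ≡ₜ C ⇒ D₂)
⇒-split {C} {D} {A} {B} C⇒D≡A∧B
  with split-↭ (factors A) (factors B) (factors-↭ C⇒D≡A∧B)
... | l₁ , l₂ , sp , l₁↭A , l₂↭B with interleave-map⁻ (C ⇒_) (factors D) sp
... | d₁ , d₂ , spD , refl , refl
  with ⇒-factors C d₁ (conj-of-↭ l₁↭A) | ⇒-factors C d₂ (conj-of-↭ l₂↭B)
... | D₁ , d₁≈D₁ , A≡C⇒D₁ | D₂ , d₂≈D₂ , B≡C⇒D₂ =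
  D₁ , D₂ , PointEquality.[≈]-injective _≡ₜ_ D≈D₁∧D₂ , A≡C⇒D₁ , B≡C⇒D₂
  where
  D≈D₁∧D₂ : just D ≈̂ just (D₁ ∧ D₂)
  D≈D₁∧D₂ = OptTy.trans (OptTy.sym (⋀-factors D))
              (OptTy.trans (⋀-interleave spD) (OptTy.∙-cong d₁≈D₁ d₂≈D₂))

∧-refine : ∀ {X₁ X₂ A B} → X₁ ∧ X₂ ≡ₜ A ∧ B →
  Σ[ p₁ ∈ Maybe Ty ] Σ[ q₁ ∈ Maybe Ty ] Σ[ p₂ ∈ Maybe Ty ] Σ[ q₂ ∈ Maybe Ty ]
  (just X₁ ≈̂ p₁ ∧̂ q₁ × just X₂ ≈̂ p₂ ∧̂ q₂ × just A ≈̂ p₁ ∧̂ p₂ × just B ≈̂ q₁ ∧̂ q₂)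
∧-refine {X₁} {X₂} {A} {B} X₁∧X₂≡A∧B
  with split-↭ (factors A) (factors B) (factors-↭ X₁∧X₂≡A∧B)
... | l₁ , l₂ , sp , l₁↭A , l₂↭B with interleave-++⁻ (factors X₁) sp
... | xa , xb , ya , yb , sp₁ , sp₂ , refl , refl =
  ⋀ xa , ⋀ xb , ⋀ ya , ⋀ yb ,
  OptTy.trans (OptTy.sym (⋀-factors X₁)) (⋀-interleave sp₁) ,
  OptTy.trans (OptTy.sym (⋀-factors X₂)) (⋀-interleave sp₂) ,
  OptTy.trans (conj-of-↭ l₁↭A) (⋀-++ xa ya) ,
  OptTy.trans (conj-of-↭ l₂↭B) (⋀-++ xb yb)

infix 4 _≃_
_≃_ : Rel Tm 0ℓ
_≃_ = Star _⇄_

≃-isEquivalence : IsEquivalence _≃_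
≃-isEquivalence = record { refl = ε ; sym = reverse ⇄-sym ; trans = _◅◅_ }

≃-ƛ : ∀ {A u v} → u ≃ v → ƛ A u ≃ ƛ A v
≃-ƛ = gmap (ƛ _) ⇄-lam

≃-·ˡ : ∀ {u v t} → u ≃ v → u · t ≃ v · t
≃-·ˡ = gmap (_· _) ⇄-appL

≃-π : ∀ {A u v} → u ≃ v → π A u ≃ π A v
≃-π = gmap (π _) ⇄-proj

≃-⊗ : ∀ {u u' v v'} → u ≃ u' → v ≃ v' → u ⊗ v ≃ u' ⊗ v'
≃-⊗ u≃u' v≃v' = gmap (_⊗ _) ⇄-pairL u≃u' ◅◅ gmap (_ ⊗_) ⇄-pairR v≃v'

⊗-isCommutativeSemigroup : IsCommutativeSemigroup _≃_ _⊗_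
⊗-isCommutativeSemigroup = record
  { isSemigroup = record
    { isMagma = record { isEquivalence = ≃-isEquivalence ; ∙-cong = ≃-⊗ }
    ; assoc   = λ _ _ _ → ⇄-assoc ◅ ε
    }
  ; comm = λ _ _ → ⇄-comm ◅ ε
  }

infixr 6 _⊗̂_
infix 4 _≃̂_

_⊗̂_ : Maybe Tm → Maybe Tm → Maybe Tm
_⊗̂_ = liftOp _⊗_

_≃̂_ : Rel (Maybe Tm) 0ℓ
_≃̂_ = PointEquality._≈∙_ _≃_

⊗̂-commutativeMonoid : CommutativeMonoid 0ℓ 0ℓ
⊗̂-commutativeMonoid = AdjoinUnit.commutativeMonoid ⊗-isCommutativeSemigroup

module OptTm = CommutativeMonoid ⊗̂-commutativeMonoid

⊗̂-interchange : ∀ a b c d → (a ⊗̂ b) ⊗̂ (c ⊗̂ d) ≃̂ (a ⊗̂ c) ⊗̂ (b ⊗̂ d)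
⊗̂-interchange = CommutativeSemigroupProperties.interchange OptTm.commutativeSemigroup

infix 4 _⊢̂_∶_
_⊢̂_∶_ : Ctx → Maybe Tm → Maybe Ty → Set
Γ ⊢̂ a ∶ p = Pointwise (Γ ⊢_∶_) a p

⊢̂-⊗ : ∀ {Γ a b p q} → Γ ⊢̂ a ∶ p → Γ ⊢̂ b ∶ q → Γ ⊢̂ a ⊗̂ b ∶ p ∧̂ q
⊢̂-⊗ (just da) (just db) = just (ty-pair da db)
⊢̂-⊗ (just da) nothing   = just da
⊢̂-⊗ nothing   (just db) = just db
⊢̂-⊗ nothing   nothing   = nothing

Splitting : Ctx → Tm → Ty → Ty → Set
Splitting Γ t A B =
  Σ[ a ∈ Tm ] Σ[ b ∈ Tm ] (Γ ⊢ a ∶ A × Γ ⊢ b ∶ B × t ≃ a ⊗ b)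

-- The same with either side allowed to be absent; needed because a
-- component of a pair may contribute to only one side of A ∧ B.
PartialSplitting : Ctx → Tm → Maybe Ty → Maybe Ty → Set
PartialSplitting Γ t p q =
  Σ[ a ∈ Maybe Tm ] Σ[ b ∈ Maybe Tm ]
  (Γ ⊢̂ a ∶ p × Γ ⊢̂ b ∶ q × just t ≃̂ a ⊗̂ b)

partial : ∀ {Γ t A B} → Splitting Γ t A B → PartialSplitting Γ t (just A) (just B)
partial (a , b , da , db , t≃a⊗b) = just a , just b , just da , just db , [ t≃a⊗b ]

complete : ∀ {Γ t p q A B} → PartialSplitting Γ t p q →
  p ≈̂ just A → q ≈̂ just B → Splitting Γ t A B
complete (_ , _ , just da , just db , [ t≃a⊗b ]) [ P≡A ] [ Q≡B ] =
  _ , _ , ty-conv da P≡A , ty-conv db Q≡B , t≃a⊗b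

⊗-partialSplitting : ∀ {Γ t₁ t₂ p₁ q₁ p₂ q₂} →
  PartialSplitting Γ t₁ p₁ q₁ → PartialSplitting Γ t₂ p₂ q₂ →
  PartialSplitting Γ (t₁ ⊗ t₂) (p₁ ∧̂ p₂) (q₁ ∧̂ q₂)
⊗-partialSplitting (a₁ , b₁ , da₁ , db₁ , t₁≃) (a₂ , b₂ , da₂ , db₂ , t₂≃) =
  a₁ ⊗̂ a₂ , b₁ ⊗̂ b₂ , ⊢̂-⊗ da₁ da₂ , ⊢̂-⊗ db₁ db₂ ,
  OptTm.trans (OptTm.∙-cong t₁≃ t₂≃) (⊗̂-interchange a₁ b₁ a₂ b₂)

ƛ-inversion : ∀ {Γ A r T} → Γ ⊢ ƛ A r ∶ T →
  Σ[ B ∈ Ty ] ((A ∷ Γ) ⊢ r ∶ B × A ⇒ B ≡ₜ T)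
ƛ-inversion (ty-lam d) = _ , d , ≡ₜ-refl
ƛ-inversion (ty-conv d e) =
  let (B , d' , e') = ƛ-inversion d in B , d' , ≡ₜ-trans e' e

·-inversion : ∀ {Γ r s T} → Γ ⊢ r · s ∶ T →
  Σ[ A ∈ Ty ] Σ[ B ∈ Ty ] (Γ ⊢ r ∶ A ⇒ B × Γ ⊢ s ∶ A × B ≡ₜ T)
·-inversion (ty-app dr ds) = _ , _ , dr , ds , ≡ₜ-refl
·-inversion (ty-conv d e) =
  let (A , B , dr , ds , e') = ·-inversion d in A , B , dr , ds , ≡ₜ-trans e' e

⊗-inversion : ∀ {Γ r s T} → Γ ⊢ r ⊗ s ∶ T →
  Σ[ A ∈ Ty ] Σ[ B ∈ Ty ] (Γ ⊢ r ∶ A × Γ ⊢ s ∶ B × A ∧ B ≡ₜ T)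
⊗-inversion (ty-pair dr ds) = _ , _ , dr , ds , ≡ₜ-refl
⊗-inversion (ty-conv d e) =
  let (A , B , dr , ds , e') = ⊗-inversion d in A , B , dr , ds , ≡ₜ-trans e' e

π-inversion : ∀ {Γ A r T} → Γ ⊢ π A r ∶ T → Σ[ B ∈ Ty ] (Γ ⊢ r ∶ A ∧ B × A ≡ₜ T)
π-inversion (ty-proj d) = _ , d , ≡ₜ-refl
π-inversion (ty-conv d e) =
  let (B , d' , e') = π-inversion d in B , d' , ≡ₜ-trans e' e

closed-var-untypable : ∀ {i T} → [] ⊢ var i ∶ T → ⊥
closed-var-untypable (ty-var ())
closed-var-untypable (ty-conv d _) = closed-var-untypable d

TypingPreserved : Tm → Tm → Set
TypingPreserved u v = ∀ {Γ T} → Γ ⊢ u ∶ T → Γ ⊢ v ∶ T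

comm-typing : ∀ {r s} → TypingPreserved (r ⊗ s) (s ⊗ r)
comm-typing d =
  let (A , B , dr , ds , e) = ⊗-inversion d
  in  ty-conv (ty-pair ds dr) (≡ₜ-trans ∧-comm e)

assoc-typing : ∀ {r s t} → TypingPreserved ((r ⊗ s) ⊗ t) (r ⊗ (s ⊗ t))
assoc-typing d =
  let (X , C , drs , dt , e)  = ⊗-inversion d
      (A , B , dr , ds , e') = ⊗-inversion drs
  in  ty-conv (ty-pair dr (ty-pair ds dt))
              (≡ₜ-trans ∧-assoc (≡ₜ-trans (∧-cong e' ≡ₜ-refl) e))

assoc⁻¹-typing : ∀ {r s t} → TypingPreserved (r ⊗ (s ⊗ t)) ((r ⊗ s) ⊗ t)
assoc⁻¹-typing d =
  let (A , Y , dr , dst , e)  = ⊗-inversion d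
      (B , C , ds , dt , e') = ⊗-inversion dst
  in  ty-conv (ty-pair (ty-pair dr ds) dt)
              (≡ₜ-trans (≡ₜ-sym ∧-assoc) (≡ₜ-trans (∧-cong ≡ₜ-refl e') e))

dist-typing : ∀ {A r s} → TypingPreserved (ƛ A (r ⊗ s)) (ƛ A r ⊗ ƛ A s)
dist-typing d =
  let (B , drs , e)            = ƛ-inversion d
      (B₁ , B₂ , dr , ds , e') = ⊗-inversion drs
  in  ty-conv (ty-pair (ty-lam dr) (ty-lam ds))
              (≡ₜ-trans (≡ₜ-sym ⇒-distr) (≡ₜ-trans (⇒-cong ≡ₜ-refl e') e))

dist⁻¹-typing : ∀ {A r s} → TypingPreserved (ƛ A r ⊗ ƛ A s) (ƛ A (r ⊗ s))
dist⁻¹-typing d =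
  let (X , Y , dλr , dλs , e) = ⊗-inversion d
      (B₁ , dr , e₁)          = ƛ-inversion dλr
      (B₂ , ds , e₂)          = ƛ-inversion dλs
  in  ty-conv (ty-lam (ty-pair dr ds)) (≡ₜ-trans ⇒-distr (≡ₜ-trans (∧-cong e₁ e₂) e))

curry-typing : ∀ {r s t} → TypingPreserved (r · s · t) (r · (s ⊗ t))
curry-typing d =
  let (C , D , drs , dt , e)  = ·-inversion d
      (B , E , dr , ds , e') = ·-inversion drs
  in  ty-conv (ty-app (ty-conv dr (≡ₜ-trans (⇒-cong ≡ₜ-refl e') (≡ₜ-sym ⇒-curry)))
                      (ty-pair ds dt)) e

curry⁻¹-typing : ∀ {r s t} → TypingPreserved (r · (s ⊗ t)) (r · s · t)
curry⁻¹-typing d =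
  let (X , D , dr , dst , e) = ·-inversion d
      (B , C , ds , dt , e') = ⊗-inversion dst
  in  ty-conv (ty-app (ty-app (ty-conv dr (≡ₜ-trans (⇒-cong (≡ₜ-sym e') ≡ₜ-refl) ⇒-curry))
                              ds) dt) e

ƛ-typing : ∀ {A u v} → TypingPreserved u v → TypingPreserved (ƛ A u) (ƛ A v)
ƛ-typing u→v d = let (B , du , e) = ƛ-inversion d in ty-conv (ty-lam (u→v du)) e

·ˡ-typing : ∀ {u v t} → TypingPreserved u v → TypingPreserved (u · t) (v · t)
·ˡ-typing u→v d =
  let (A , B , du , dt , e) = ·-inversion d in ty-conv (ty-app (u→v du) dt) e

·ʳ-typing : ∀ {u v t} → TypingPreserved u v → TypingPreserved (t · u) (t · v)
·ʳ-typing u→v d =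
  let (A , B , dt , du , e) = ·-inversion d in ty-conv (ty-app dt (u→v du)) e

⊗ˡ-typing : ∀ {u v t} → TypingPreserved u v → TypingPreserved (u ⊗ t) (v ⊗ t)
⊗ˡ-typing u→v d =
  let (A , B , du , dt , e) = ⊗-inversion d in ty-conv (ty-pair (u→v du) dt) e

⊗ʳ-typing : ∀ {u v t} → TypingPreserved u v → TypingPreserved (t ⊗ u) (t ⊗ v)
⊗ʳ-typing u→v d =
  let (A , B , dt , du , e) = ⊗-inversion d in ty-conv (ty-pair dt (u→v du)) e

π-typing : ∀ {A u v} → TypingPreserved u v → TypingPreserved (π A u) (π A v)
π-typing u→v d = let (B , du , e) = π-inversion d in ty-conv (ty-proj (u→v du)) e

-- Since ⇄ is closed under symmetry, both directions are proved together.
⇄-typing : ∀ {u v} → u ⇄ v → TypingPreserved u v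
⇄-typing⁻¹ : ∀ {u v} → u ⇄ v → TypingPreserved v u

⇄-typing ⇄-comm      = comm-typing
⇄-typing ⇄-assoc     = assoc-typing
⇄-typing ⇄-dist      = dist-typing
⇄-typing ⇄-curry     = curry-typing
⇄-typing (⇄-sym p)   = ⇄-typing⁻¹ p
⇄-typing (⇄-lam p)   = ƛ-typing (⇄-typing p)
⇄-typing (⇄-appL p)  = ·ˡ-typing (⇄-typing p)
⇄-typing (⇄-appR p)  = ·ʳ-typing (⇄-typing p)
⇄-typing (⇄-pairL p) = ⊗ˡ-typing (⇄-typing p)
⇄-typing (⇄-pairR p) = ⊗ʳ-typing (⇄-typing p)
⇄-typing (⇄-proj p)  = π-typing (⇄-typing p)

⇄-typing⁻¹ ⇄-comm      = comm-typing
⇄-typing⁻¹ ⇄-assoc     = assoc⁻¹-typing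
⇄-typing⁻¹ ⇄-dist      = dist⁻¹-typing
⇄-typing⁻¹ ⇄-curry     = curry⁻¹-typing
⇄-typing⁻¹ (⇄-sym p)   = ⇄-typing p
⇄-typing⁻¹ (⇄-lam p)   = ƛ-typing (⇄-typing⁻¹ p)
⇄-typing⁻¹ (⇄-appL p)  = ·ˡ-typing (⇄-typing⁻¹ p)
⇄-typing⁻¹ (⇄-appR p)  = ·ʳ-typing (⇄-typing⁻¹ p)
⇄-typing⁻¹ (⇄-pairL p) = ⊗ˡ-typing (⇄-typing⁻¹ p)
⇄-typing⁻¹ (⇄-pairR p) = ⊗ʳ-typing (⇄-typing⁻¹ p)
⇄-typing⁻¹ (⇄-proj p)  = π-typing (⇄-typing⁻¹ p)

≃-typing : ∀ {u v} → u ≃ v → TypingPreserved u v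
≃-typing ε        d = d
≃-typing (p ◅ ps) d = ≃-typing ps (⇄-typing p d)

typed-chain : ∀ {Γ u v T} → Γ ⊢ u ∶ T → u ≃ v → Γ ⊢ u ⇄* v
typed-chain d ε        = ε
typed-chain d (p ◅ ps) =
  ((_ , d) , p , (_ , ⇄-typing p d)) ◅ typed-chain (⇄-typing p d) ps

isIntro : Tm → Bool
isIntro (ƛ _ _) = true
isIntro (_ ⊗ _) = true
isIntro (var _) = false
isIntro (_ · _) = false
isIntro (π _ _) = false

⇄-isIntro : ∀ {u v} → u ⇄ v → isIntro u ≡ isIntro v
⇄-isIntro ⇄-comm      = refl
⇄-isIntro ⇄-assoc     = refl
⇄-isIntro ⇄-dist      = refl
⇄-isIntro ⇄-curry     = refl
⇄-isIntro (⇄-sym p)   = ≡.sym (⇄-isIntro p)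
⇄-isIntro (⇄-lam p)   = refl
⇄-isIntro (⇄-appL p)  = refl
⇄-isIntro (⇄-appR p)  = refl
⇄-isIntro (⇄-pairL p) = refl
⇄-isIntro (⇄-pairR p) = refl
⇄-isIntro (⇄-proj p)  = refl

≃-isIntro : ∀ {u v} → u ≃ v → isIntro u ≡ isIntro v
≃-isIntro ε        = refl
≃-isIntro (p ◅ ps) = ≡.trans (⇄-isIntro p) (≃-isIntro ps)

intro-not-elim : ∀ {r} → isIntro r ≡ true → ElimOrVar r → ⊥
intro-not-elim () ev-var
intro-not-elim () ev-app
intro-not-elim () ev-proj

Normal : (Ctx → Tm → Tm → Set) → Ctx → Tm → Ty → Set
Normal _⊢_⇝_ Γ t T = ∀ {t' s'} → t ≃ t' → Γ ⊢ t' ⇝ s' → Γ ⊢ s' ∶ T → ⊥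

normal-conv : ∀ R {Γ t T T'} → T ≡ₜ T' → Normal R Γ t T → Normal R Γ t T'
normal-conv R T≡T' n t≃t' t'⇝s' ds' = n t≃t' t'⇝s' (ty-conv ds' (≡ₜ-sym T≡T'))

normal-π : ∀ {Γ A B t} → Normal _⊢_↪_ Γ (π A t) A → Normal _⊢_↪_ Γ t (A ∧ B)
normal-π n t≃t' t'↪s' ds' = n (≃-π t≃t') (↪-proj t'↪s') (ty-proj ds')

normal-·ˡ : ∀ {Γ E D f a} → Γ ⊢ a ∶ E →
  Normal _⊢_↪_ Γ (f · a) D → Normal _⊢_↪_ Γ f (E ⇒ D)
normal-·ˡ da n f≃f' f'↪s' ds' = n (≃-·ˡ f≃f') (↪-appL f'↪s') (ty-app ds' da)

normal-ƛ : ∀ {Γ C D b} → Normal _⊢_⟶_ Γ (ƛ C b) (C ⇒ D) → Normal _⊢_⟶_ (C ∷ Γ) b D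
normal-ƛ n b≃b' b'⟶s' ds' = n (≃-ƛ b≃b') (⟶-↪ (↪-lam b'⟶s')) (ty-lam ds')

normal-⊗ˡ : ∀ {Γ t₁ t₂ X₁ X₂} → Γ ⊢ t₂ ∶ X₂ →
  Normal _⊢_⟶_ Γ (t₁ ⊗ t₂) (X₁ ∧ X₂) → Normal _⊢_⟶_ Γ t₁ X₁
normal-⊗ˡ d₂ n t≃t' t'⟶s' ds' =
  n (≃-⊗ t≃t' ε) (⟶-↪ (↪-pairL t'⟶s')) (ty-pair ds' d₂)

normal-⊗ʳ : ∀ {Γ t₁ t₂ X₁ X₂} → Γ ⊢ t₁ ∶ X₁ →
  Normal _⊢_⟶_ Γ (t₁ ⊗ t₂) (X₁ ∧ X₂) → Normal _⊢_⟶_ Γ t₂ X₂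
normal-⊗ʳ d₁ n t≃t' t'⟶s' ds' =
  n (≃-⊗ ε t≃t') (⟶-↪ (↪-pairR t'⟶s')) (ty-pair d₁ ds')

-- η and δ only expand variables and eliminations, and everything
-- ≃-equivalent to an introduction is one; so for introductions
-- ↪-normality already is ⟶-normality.
normal-intro : ∀ {Γ t T} → isIntro t ≡ true →
  Normal _⊢_↪_ Γ t T → Normal _⊢_⟶_ Γ t T
normal-intro intro n t≃t' (⟶-↪ t'↪s') ds' = n t≃t' t'↪s' ds'
normal-intro intro n t≃t' (⟶-ηδ (η _ ev)) _ =
  intro-not-elim (≡.trans (≡.sym (≃-isIntro t≃t')) intro) ev
normal-intro intro n t≃t' (⟶-ηδ (δ _ ev)) _ =
  intro-not-elim (≡.trans (≡.sym (≃-isIntro t≃t')) intro) ev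

-- A variable or elimination of product type is a δ-redex.
elim-not-normal : ∀ {Γ t A B} → ElimOrVar t → Γ ⊢ t ∶ A ∧ B →
  Normal _⊢_⟶_ Γ t (A ∧ B) → ⊥
elim-not-normal ev d n =
  n ε (⟶-ηδ (δ d ev)) (ty-pair (ty-proj d) (ty-proj (ty-conv d ∧-comm)))

-- A ⟶-normal term of type A ∧ B splits; the partial version handles a
-- type X ≡ₜ p ∧̂ q where one side may be empty, in which case t itself
-- is the only component.
split-normal : ∀ {Γ A B} t → Γ ⊢ t ∶ A ∧ B →
  Normal _⊢_⟶_ Γ t (A ∧ B) → Splitting Γ t A B
split-normal? : ∀ {Γ X p q} t → Γ ⊢ t ∶ X → just X ≈̂ p ∧̂ q →
  Normal _⊢_⟶_ Γ t X → PartialSplitting Γ t p q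

split-normal (var i) d n = ⊥-elim (elim-not-normal ev-var d n)
split-normal (f · a) d n = ⊥-elim (elim-not-normal ev-app d n)
split-normal (π C t) d n = ⊥-elim (elim-not-normal ev-proj d n)
split-normal (ƛ C b) d n with ƛ-inversion d
... | D , db , C⇒D≡A∧B with ⇒-split C⇒D≡A∧B
... | D₁ , D₂ , D≡D₁∧D₂ , A≡C⇒D₁ , B≡C⇒D₂
  with split-normal b (ty-conv db D≡D₁∧D₂)
         (normal-conv _⊢_⟶_ D≡D₁∧D₂ (normal-ƛ (normal-conv _⊢_⟶_ (≡ₜ-sym C⇒D≡A∧B) n)))
... | b₁ , b₂ , db₁ , db₂ , b≃b₁⊗b₂ =
  ƛ C b₁ , ƛ C b₂ ,
  ty-conv (ty-lam db₁) (≡ₜ-sym A≡C⇒D₁) , ty-conv (ty-lam db₂) (≡ₜ-sym B≡C⇒D₂) ,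
  ≃-ƛ b≃b₁⊗b₂ ◅◅ (⇄-dist ◅ ε)
split-normal (t₁ ⊗ t₂) d n with ⊗-inversion d
... | X₁ , X₂ , d₁ , d₂ , X₁∧X₂≡A∧B with ∧-refine X₁∧X₂≡A∧B
... | p₁ , q₁ , p₂ , q₂ , X₁≈ , X₂≈ , A≈ , B≈ =
  complete (⊗-partialSplitting (split-normal? t₁ d₁ X₁≈ (normal-⊗ˡ d₂ n'))
                               (split-normal? t₂ d₂ X₂≈ (normal-⊗ʳ d₁ n')))
           (OptTy.sym A≈) (OptTy.sym B≈)
  where
  n' : Normal _⊢_⟶_ _ (t₁ ⊗ t₂) (X₁ ∧ X₂)
  n' = normal-conv _⊢_⟶_ (≡ₜ-sym X₁∧X₂≡A∧B) n

split-normal? {p = just P} {just Q} t d [ X≡P∧Q ] n =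
  partial (split-normal t (ty-conv d X≡P∧Q) (normal-conv _⊢_⟶_ X≡P∧Q n))
split-normal? {p = just P} {nothing} t d [ X≡P ] n =
  just t , nothing , just (ty-conv d X≡P) , nothing , [ ε ]
split-normal? {p = nothing} {just Q} t d [ X≡Q ] n =
  nothing , just t , nothing , just (ty-conv d X≡Q) , [ ε ]

-- If it were π A' t, then
-- t would split into t₁ ⊗ t₂ and π A' (t₁ ⊗ t₂) is a π-redex; if it were
-- f · a, then f would split and (f₁ ⊗ f₂) · a is a ζ-redex.
split-closed : ∀ {A B} r → [] ⊢ r ∶ A ∧ B →
  Normal _⊢_↪_ [] r (A ∧ B) → Splitting [] r A B
split-closed (var i) d n = ⊥-elim (closed-var-untypable d)
split-closed (π A' t) d n with π-inversion d
... | B' , dt , A'≡A∧B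
  with split-closed t dt (normal-π (normal-conv _⊢_↪_ (≡ₜ-sym A'≡A∧B) n))
... | t₁ , t₂ , d₁ , d₂ , t≃t₁⊗t₂ =
  ⊥-elim (n (≃-π t≃t₁⊗t₂) (↪-βπζ (π d₁)) (ty-conv d₁ A'≡A∧B))
split-closed {A} {B} (f · a) d n with ·-inversion d
... | E , D , df , da , D≡A∧B
  with split-closed f (ty-conv df E⇒D≡) (normal-conv _⊢_↪_ E⇒D≡ (normal-·ˡ da n'))
  where
  E⇒D≡ : E ⇒ D ≡ₜ (E ⇒ A) ∧ (E ⇒ B)
  E⇒D≡ = ≡ₜ-trans (⇒-cong ≡ₜ-refl D≡A∧B) ⇒-distr
  n' : Normal _⊢_↪_ [] (f · a) D
  n' = normal-conv _⊢_↪_ (≡ₜ-sym D≡A∧B) n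
... | f₁ , f₂ , d₁ , d₂ , f≃f₁⊗f₂ =
  ⊥-elim (n (≃-·ˡ f≃f₁⊗f₂) (↪-βπζ ζ) (ty-pair (ty-app d₁ da) (ty-app d₂ da)))
split-closed (ƛ C b)   d n = split-normal (ƛ C b)   d (normal-intro refl n)
split-closed (t₁ ⊗ t₂) d n = split-normal (t₁ ⊗ t₂) d (normal-intro refl n)

-- ↪⇄-irreducibility of r gives ↪-normality modulo ≃, and the untyped
-- chain produced by split-closed is a chain of terms.
mainTheorem15 : (A B : Ty) (r : Tm) → [] ⊢ r ∶ A ∧ B →
    (∀ s → ¬ ([] ⊢ r ↪⇄ s)) →
    Σ[ r₁ ∈ Tm ] Σ[ r₂ ∈ Tm ] ([] ⊢ r₁ ∶ A × [] ⊢ r₂ ∶ B × [] ⊢ r ⇄* (r₁ ⊗ r₂))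
mainTheorem15 A B r d irreducible =
  let (r₁ , r₂ , d₁ , d₂ , r≃r₁⊗r₂) = split-closed r d normal
  in  r₁ , r₂ , d₁ , d₂ , typed-chain d r≃r₁⊗r₂
  where
  normal : Normal _⊢_↪_ [] r (A ∧ B)
  normal {t'} {s'} r≃t' t'↪s' ds' = irreducible s'
    ( t' , s' , (_ , d) , (_ , ≃-typing r≃t' d) , (_ , ds') , (_ , ds')
    , typed-chain d r≃t' , t'↪s' , ε)
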